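{- Let $k$ be a field and let $W_1,\ldots,W_s$ and $\tilde W_1,\ldots,\tilde W_s$ be perfect matchings $\mathbb{Z}^2\to\mathbb{Z}$ such that $W_1+\cdots+W_s=\tilde W_1+\cdots+\tilde W_s$. Then for any $\mathbf{d}\in\mathbb{Z}^2$ there is an isomorphism of $k$-diagrams $$\mathcal{M}_{W_1,\mathbf{d}}\oplus\cdots\oplus\mathcal{M}_{W_s,\mathbf{d}}\simeq\mathcal{M}_{\tilde W_1,\mathbf{d}}\oplus\cdots\oplus\mathcal{M}_{\tilde W_s,\mathbf{d}}.$$
   Context: A perfect matching is a function $W\colon\mathbb{Z}^2\to\mathbb{Z}$ that is zero whenever $d_1+d_2$ is sufficiently small or sufficiently large, and for which there is a bijection $\pi\colon\mathbb{Z}\to\mathbb{Z}$ with $W(i,j)=1$ if $j=\pi(i)$ and $W(i,j)=0$ otherwise. A $k$-diagram $\mathcal{F}$ consists of $k$-vector spaces $\mathcal{F}(B_1),\mathcal{F}(B_2),\mathcal{F}(B_3),\mathcal{F}(A_1),\mathcal{F}(A_2)$ and linear maps $\rho_{1,1}\colon\mathcal{F}(B_1)\to\mathcal{F}(A_1)$, $\rho_{2,2}\colon\mathcal{F}(B_2)\to\mathcal{F}(A_2)$, $\rho_{3,1}\colon\mathcal{F}(B_3)\to\mathcal{F}(A_1)$, $\rho_{3,2}\colon\mathcal{F}(B_3)\to\mathcal{F}(A_2)$. A morphism $\phi\colon\mathcal{F}\to\mathcal{G}$ is a family of linear maps $\phi(P)\colon\mathcal{F}(P)\to\mathcal{G}(P)$,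 $P\in\{A_1,A_2,B_1,B_2,B_3\}$, commuting with the $\rho_{i,j}$; it is an isomorphism if all $\phi(P)$ are isomorphisms. Direct sums of $k$-diagrams are taken valuewise. For $W\colon\mathbb{Z}^2\to\mathbb{Z}_{\ge0}$, $\mathrm{Multi}(W)=\{(s_1,s_2,i): 1\le i\le W(s_1,s_2)\}$ and $k^{\oplus S}$ has basis $\{\mathbf{e}_s\}_{s\in S}$. $\mathcal{M}_{W,\mathbf{d}}$ is the $k$-diagram with $B_i$-value $k^{\oplus\mathbb{Z}_{\le d_i}}$, $A_i$-value $k^{\oplus\mathbb{Z}}$ ($i=1,2$), $\rho_{i,i}$ the inclusions, $B_3$-value $k^{\oplus\mathrm{Multi}(W)}$, and $\rho_{3,j}$ sending the basis vector of $(s_1,s_2,i)$ to $\mathbf{e}_{s_j}$. -}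

module Defs where

open import Level using (Level; _⊔_) renaming (suc to lsuc)
open import Algebra.Bundles using (CommutativeRing)
open import Data.Nat as ℕ using (ℕ)
open import Data.Integer as ℤ using (ℤ; +_; 0ℤ; 1ℤ)
import Data.Integer.Properties as ℤP
import Data.Nat.Properties as ℕP
open import Data.Fin using (Fin; zero; suc)
open import Data.List using (List; []; _∷_; _++_; map)
open import Data.Product using (Σ; ∃; _×_; _,_; proj₁; proj₂; map₂)
open import Relation.Nullary using (¬_; Dec; yes; no)
open import Relation.Binary.PropositionalEquality using (_≡_; _≢_; refl)
open import Relation.Binary.Definitions using (DecidableEquality)
open import Function.Definitions using (Bijective)

record Field (c ℓ : Level) : Set (lsuc (c ⊔ ℓ)) where
  field
    commutativeRing : CommutativeRing c ℓ
  open CommutativeRing commutativeRing public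
  field
    1≉0     : ¬ (1# ≈ 0#)
    inverse : ∀ x → ¬ (x ≈ 0#) → ∃ λ y → (x * y) ≈ 1#

∑ : ∀ {s} → (Fin s → ℤ) → ℤ
∑ {ℕ.zero}  f = 0ℤ
∑ {ℕ.suc s} f = f zero ℤ.+ ∑ (λ r → f (suc r))

IsPerfectMatching : (ℤ → ℤ → ℤ) → Set
IsPerfectMatching W =
  (∃ λ (L : ℤ) → ∃ λ (U : ℤ) → ∀ i j →
      (i ℤ.+ j ℤ.≤ L → W i j ≡ 0ℤ) × (U ℤ.≤ i ℤ.+ j → W i j ≡ 0ℤ))
  × (∃ λ (π : ℤ → ℤ) → Bijective _≡_ _≡_ π
       × (∀ i j → (j ≡ π i → W i j ≡ 1ℤ) × (j ≢ π i → W i j ≡ 0ℤ)))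

ℤ≤ : ℤ → Set
ℤ≤ d = Σ ℤ (λ n → n ℤ.≤ d)

Multi : (ℤ → ℤ → ℤ) → Set
Multi W = Σ (ℤ × ℤ × ℕ) (λ { (s₁ , s₂ , i) → (1 ℕ.≤ i) × (+ i ℤ.≤ W s₁ s₂) })

ℤ≤-≟ : ∀ d → DecidableEquality (ℤ≤ d)
ℤ≤-≟ d (n , p) (m , q) with n ℤ.≟ m
... | no n≢m = no λ { refl → n≢m refl }
... | yes refl with ℤP.≤-irrelevant p q
...   | refl = yes refl

Multi-≟ : ∀ W → DecidableEquality (Multi W)
Multi-≟ W ((a , b , i) , p , q) ((a' , b' , i') , p' , q')
  with a ℤ.≟ a' | b ℤ.≟ b' | i ℕ.≟ i'
... | no ne | _ | _ = no λ { refl → ne refl }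
... | yes refl | no ne | _ = no λ { refl → ne refl }
... | yes refl | yes refl | no ne = no λ { refl → ne refl }
... | yes refl | yes refl | yes refl
  with ℕP.≤-irrelevant p p' | ℤP.≤-irrelevant q q'
...   | refl | refl = yes refl

s₁ s₂ : ∀ {W} → Multi W → ℤ
s₁ ((a , _ , _) , _) = a
s₂ ((_ , b , _) , _) = b

module Over {c ℓ : Level} (F : Field c ℓ) where
  private
    module K = Field F
  K : Set c
  K = K.Carrier

  record Space : Set (lsuc (c ⊔ ℓ)) where
    field
      Carrier : Set c
      _≈_     : Carrier → Carrier → Set ℓ
      _+_     : Carrier → Carrier → Carrier
      _·_     : K → Carrier → Carrier
      0v      : Carrier
  open Space public

  record LinearMap (V W : Space) : Set (c ⊔ ℓ) where
    field
      fun   : Carrier V → Carrier W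
      cong  : ∀ {x y} → _≈_ V x y → _≈_ W (fun x) (fun y)
      +-hom : ∀ x y → _≈_ W (fun (_+_ V x y)) (_+_ W (fun x) (fun y))
      ·-hom : ∀ a x → _≈_ W (fun (_·_ V a x)) (_·_ W a (fun x))
  open LinearMap public

  IsLinearIso : ∀ {V W} → LinearMap V W → Set (c ⊔ ℓ)
  IsLinearIso {V} {W} f = Σ (LinearMap W V) λ g →
    (∀ x → _≈_ V (fun g (fun f x)) x) × (∀ y → _≈_ W (fun f (fun g y)) y)

  -- k^{⊕ S}: finite formal linear combinations, identified when all
  -- coefficients agree.
  module _ {S : Set} (_≟_ : DecidableEquality S) where
    coeff : List (K × S) → S → K
    coeff [] t = K.0#
    coeff ((a , s) ∷ l) t with s ≟ t
    ... | yes _ = a K.+ coeff l t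
    ... | no _  = coeff l t

    Free : Space
    Free = record
      { Carrier = List (K × S)
      ; _≈_     = λ x y → ∀ t → coeff x t K.≈ coeff y t
      ; _+_     = _++_
      ; _·_     = λ a → map (λ { (b , s) → (a K.* b , s) })
      ; 0v      = []
      }

    e : S → List (K × S)
    e s = (K.1# , s) ∷ []

  induced : ∀ {S T : Set} → (S → T) → List (K × S) → List (K × T)
  induced f = map (map₂ f)

  record Diagram : Set (lsuc (c ⊔ ℓ)) where
    field
      B₁ B₂ B₃ A₁ A₂ : Space
      ρ₁₁ : Carrier B₁ → Carrier A₁
      ρ₂₂ : Carrier B₂ → Carrier A₂
      ρ₃₁ : Carrier B₃ → Carrier A₁
      ρ₃₂ : Carrier B₃ → Carrier A₂
  open Diagram public

  record Morphism (𝓕 𝓖 : Diagram) : Set (c ⊔ ℓ) where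
    field
      φB₁ : LinearMap (B₁ 𝓕) (B₁ 𝓖)
      φB₂ : LinearMap (B₂ 𝓕) (B₂ 𝓖)
      φB₃ : LinearMap (B₃ 𝓕) (B₃ 𝓖)
      φA₁ : LinearMap (A₁ 𝓕) (A₁ 𝓖)
      φA₂ : LinearMap (A₂ 𝓕) (A₂ 𝓖)
      comm₁₁ : ∀ x → _≈_ (A₁ 𝓖) (ρ₁₁ 𝓖 (fun φB₁ x)) (fun φA₁ (ρ₁₁ 𝓕 x))
      comm₂₂ : ∀ x → _≈_ (A₂ 𝓖) (ρ₂₂ 𝓖 (fun φB₂ x)) (fun φA₂ (ρ₂₂ 𝓕 x))
      comm₃₁ : ∀ x → _≈_ (A₁ 𝓖) (ρ₃₁ 𝓖 (fun φB₃ x)) (fun φA₁ (ρ₃₁ 𝓕 x))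
      comm₃₂ : ∀ x → _≈_ (A₂ 𝓖) (ρ₃₂ 𝓖 (fun φB₃ x)) (fun φA₂ (ρ₃₂ 𝓕 x))
  open Morphism public

  IsIso : ∀ {𝓕 𝓖} → Morphism 𝓕 𝓖 → Set (c ⊔ ℓ)
  IsIso φ = IsLinearIso (φB₁ φ) × IsLinearIso (φB₂ φ) × IsLinearIso (φB₃ φ)
          × IsLinearIso (φA₁ φ) × IsLinearIso (φA₂ φ)

  _≅_ : Diagram → Diagram → Set (c ⊔ ℓ)
  𝓕 ≅ 𝓖 = Σ (Morphism 𝓕 𝓖) IsIso

  ⨁ˢ : ∀ {s} → (Fin s → Space) → Space
  ⨁ˢ {s} V = record
    { Carrier = (r : Fin s) → Carrier (V r)
    ; _≈_     = λ x y → ∀ r → _≈_ (V r) (x r) (y r)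
    ; _+_     = λ x y r → _+_ (V r) (x r) (y r)
    ; _·_     = λ a x r → _·_ (V r) a (x r)
    ; 0v      = λ r → 0v (V r)
    }

  ⨁ : ∀ {s} → (Fin s → Diagram) → Diagram
  ⨁ 𝓕 = record
    { B₁ = ⨁ˢ (λ r → B₁ (𝓕 r))
    ; B₂ = ⨁ˢ (λ r → B₂ (𝓕 r))
    ; B₃ = ⨁ˢ (λ r → B₃ (𝓕 r))
    ; A₁ = ⨁ˢ (λ r → A₁ (𝓕 r))
    ; A₂ = ⨁ˢ (λ r → A₂ (𝓕 r))
    ; ρ₁₁ = λ x r → ρ₁₁ (𝓕 r) (x r)
    ; ρ₂₂ = λ x r → ρ₂₂ (𝓕 r) (x r)
    ; ρ₃₁ = λ x r → ρ₃₁ (𝓕 r) (x r)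
    ; ρ₃₂ = λ x r → ρ₃₂ (𝓕 r) (x r)
    }

  𝓜 : (ℤ → ℤ → ℤ) → ℤ × ℤ → Diagram
  𝓜 W (d₁ , d₂) = record
    { B₁ = Free (ℤ≤-≟ d₁)
    ; B₂ = Free (ℤ≤-≟ d₂)
    ; B₃ = Free (Multi-≟ W)
    ; A₁ = Free ℤ._≟_
    ; A₂ = Free ℤ._≟_
    ; ρ₁₁ = induced proj₁
    ; ρ₂₂ = induced proj₁
    ; ρ₃₁ = induced (s₁ {W})
    ; ρ₃₂ = induced (s₂ {W})
    }

{-# OPTIONS --safe #-}
module Submission where

-- Every value of 𝓜_{W,d} is a free vector space on an index set and every structure map
-- is induced by a map of index sets, so it suffices to biject the index sets of the two
-- direct sums compatibly with these maps. For an edge (a, b) the summands r with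
-- W_r(a, b) = 1 are counted by (W_1 + ⋯ + W_s)(a, b), so the hypothesis gives a bijection
-- between them and the corresponding summands of the W̃_r. Since each W_r is the graph of a
-- bijection π_r, a pair (r, a) determines the edge (a, π_r a) and a pair (r, b) the edge
-- (π_r⁻¹ b, b); hence the bijections on edges induce a permutation of the summands for
-- each row a (reindexing A₁ and B₁), each column b (reindexing A₂ and B₂), and a
-- bijection of the multisets Multi(W_r) (reindexing B₃), and all squares commute.

open import Defs
open import Level using (Level; _⊔_)
open import Data.Nat as ℕ using (ℕ; zero; suc; z≤n; s≤s)
import Data.Nat.Properties as ℕ
open import Data.Integer as ℤ using (ℤ; +_; 0ℤ; 1ℤ; +≤+)
import Data.Integer.Properties as ℤ
open import Data.Fin as Fin using (Fin; zero; suc)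
open import Data.List using (List; []; _∷_; _++_)
open import Data.Product as Prod using (Σ; ∃; _×_; _,_; proj₁; proj₂; map₂)
open import Data.Product.Properties using (≡-dec)
open import Data.Sum using (_⊎_; inj₁; inj₂)
open import Data.Empty using (⊥-elim)
open import Function.Base using (id)
open import Function.Bundles using (_↔_; Inverse; Injection; mk↔ₛ′)
open import Function.Definitions using (Injective)
open import Function.Properties.Inverse using (↔-sym; ↔⇒↣)
open import Function.Construct.Composition using (_↔-∘_)
open import Axiom.UniquenessOfIdentityProofs using (module Decidable⇒UIP)
open import Relation.Nullary using (¬_; Dec; yes; no)
import Relation.Nullary.Decidable as Dec
open import Relation.Binary.Definitions using (DecidableEquality)
open import Relation.Binary.PropositionalEquality as ≡ using (_≡_; _≢_; refl)

open Inverse using (to; from; strictlyInverseˡ; strictlyInverseʳ)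

-- Bijections

module _ {A B C D : Set} (σ : A ↔ B) (υ : C ↔ D) {h : A → C} {k : B → D}
         (square : ∀ a → to υ (h a) ≡ k (to σ a)) where
  open ≡.≡-Reasoning

  square-from : ∀ b → from υ (k b) ≡ h (from σ b)
  square-from b = begin
    from υ (k b)                 ≡⟨ ≡.cong (λ b → from υ (k b)) (strictlyInverseˡ σ b) ⟨
    from υ (k (to σ (from σ b))) ≡⟨ ≡.cong (from υ) (square (from σ b)) ⟨
    from υ (to υ (h (from σ b))) ≡⟨ strictlyInverseʳ υ _ ⟩
    h (from σ b)                 ∎

  square-from⁻¹ : ∀ {a d} → from υ d ≡ h a → d ≡ k (to σ a)
  square-from⁻¹ {a} {d} e = begin
    d                  ≡⟨ strictlyInverseˡ υ d ⟨
    to υ (from υ d)    ≡⟨ ≡.cong (to υ) e ⟩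
    to υ (h a)         ≡⟨ square a ⟩
    k (to σ a)         ∎

Σ-map₂-↔ : ∀ {I : Set} {A B : I → Set} → (∀ i → A i ↔ B i) → Σ I A ↔ Σ I B
Σ-map₂-↔ f = mk↔ₛ′ (map₂ (to (f _))) (map₂ (from (f _)))
                   (λ (i , b) → ≡.cong (i ,_) (strictlyInverseˡ (f i) b))
                   (λ (i , a) → ≡.cong (i ,_) (strictlyInverseʳ (f i) a))

fibrewise-↔ : ∀ {s} {X : Set} → (X → Fin s ↔ Fin s) → Σ (Fin s) (λ _ → X) ↔ Σ (Fin s) (λ _ → X)
fibrewise-↔ σ = mk↔ₛ′ (λ (r , x) → to (σ x) r , x) (λ (r , x) → from (σ x) r , x)
                      (λ (r , x) → ≡.cong (_, x) (strictlyInverseˡ (σ x) r))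
                      (λ (r , x) → ≡.cong (_, x) (strictlyInverseʳ (σ x) r))

module _ {s n : ℕ} {P : Fin (suc s) → Set} where

  Σ-Fin-suc-↔-Fin-suc : (p₀ : P zero) → (∀ p → p ≡ p₀) →
                        Σ (Fin s) (λ r → P (suc r)) ↔ Fin n → Σ (Fin (suc s)) P ↔ Fin (suc n)
  Σ-Fin-suc-↔-Fin-suc p₀ p≡p₀ f = mk↔ₛ′ forth back forth∘back back∘forth
    where
    forth : Σ (Fin (suc s)) P → Fin (suc n)
    forth (zero  , _) = zero
    forth (suc r , p) = suc (to f (r , p))

    back : Fin (suc n) → Σ (Fin (suc s)) P
    back zero    = zero , p₀
    back (suc k) = Prod.map suc id (from f k)

    forth∘back : ∀ k → forth (back k) ≡ k
    forth∘back zero    = refl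
    forth∘back (suc k) = ≡.cong suc (strictlyInverseˡ f k)

    back∘forth : ∀ q → back (forth q) ≡ q
    back∘forth (zero  , p) = ≡.cong (zero ,_) (≡.sym (p≡p₀ p))
    back∘forth (suc r , p) = ≡.cong (Prod.map suc id) (strictlyInverseʳ f (r , p))

  Σ-Fin-suc-↔-Fin : ¬ P zero → Σ (Fin s) (λ r → P (suc r)) ↔ Fin n → Σ (Fin (suc s)) P ↔ Fin n
  Σ-Fin-suc-↔-Fin ¬p₀ f = mk↔ₛ′ forth back (strictlyInverseˡ f) back∘forth
    where
    forth : Σ (Fin (suc s)) P → Fin n
    forth (zero  , p) = ⊥-elim (¬p₀ p)
    forth (suc r , p) = to f (r , p)

    back : Fin n → Σ (Fin (suc s)) P
    back k = Prod.map suc id (from f k)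

    back∘forth : ∀ q → back (forth q) ≡ q
    back∘forth (zero  , p) = ⊥-elim (¬p₀ p)
    back∘forth (suc r , p) = ≡.cong (Prod.map suc id) (strictlyInverseʳ f (r , p))

-- Sums of 0/1-valued functions

0ℤ≢1ℤ : 0ℤ ≢ 1ℤ
0ℤ≢1ℤ ()

ℤ-≡-irrelevant : ∀ {x y : ℤ} (p q : x ≡ y) → p ≡ q
ℤ-≡-irrelevant = Decidable⇒UIP.≡-irrelevant ℤ._≟_

support-↔-Fin : ∀ {s} (w : Fin s → ℤ) → (∀ r → w r ≡ 0ℤ ⊎ w r ≡ 1ℤ) →
                Σ ℕ λ n → ∑ w ≡ + n × (Σ (Fin s) (λ r → w r ≡ 1ℤ) ↔ Fin n)
support-↔-Fin {zero}  w w01 = 0 , refl , mk↔ₛ′ (λ ()) (λ ()) (λ ()) (λ ())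
support-↔-Fin {suc s} w w01 with support-↔-Fin (λ r → w (suc r)) (λ r → w01 (suc r)) | w01 zero
... | n , ∑≡n , f | inj₁ w₀≡0 =
  n , ≡.cong₂ ℤ._+_ w₀≡0 ∑≡n , Σ-Fin-suc-↔-Fin (λ w₀≡1 → 0ℤ≢1ℤ (≡.trans (≡.sym w₀≡0) w₀≡1)) f
... | n , ∑≡n , f | inj₂ w₀≡1 =
  suc n , ≡.cong₂ ℤ._+_ w₀≡1 ∑≡n , Σ-Fin-suc-↔-Fin-suc w₀≡1 (λ p → ℤ-≡-irrelevant p w₀≡1) f

equal-sums⇒supports-↔ : ∀ {s} (w w̃ : Fin s → ℤ) →
                        (∀ r → w r ≡ 0ℤ ⊎ w r ≡ 1ℤ) → (∀ r → w̃ r ≡ 0ℤ ⊎ w̃ r ≡ 1ℤ) → ∑ w ≡ ∑ w̃ →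
                        Σ (Fin s) (λ r → w r ≡ 1ℤ) ↔ Σ (Fin s) (λ r → w̃ r ≡ 1ℤ)
equal-sums⇒supports-↔ w w̃ w01 w̃01 ∑≡∑ with support-↔-Fin w w01 | support-↔-Fin w̃ w̃01
... | n , ∑w≡n , f | ñ , ∑w̃≡ñ , f̃ with ℤ.+-injective (≡.trans (≡.sym ∑w≡n) (≡.trans ∑≡∑ ∑w̃≡ñ))
...   | refl = ↔-sym f̃ ↔-∘ f

-- Perfect matchings

module _ {s} {X : Set} (w : Fin s → X → ℤ) (f : Fin s → X)
         (edge⇒f : ∀ {r x} → w r x ≡ 1ℤ → x ≡ f r) (f-edge : ∀ r → w r (f r) ≡ 1ℤ) where

  Fin↔graph : Fin s ↔ Σ X (λ x → Σ (Fin s) (λ r → w r x ≡ 1ℤ))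
  Fin↔graph = mk↔ₛ′ forth back forth∘back (λ _ → refl)
    where
    forth : Fin s → Σ X (λ x → Σ (Fin s) (λ r → w r x ≡ 1ℤ))
    forth r = f r , r , f-edge r

    back : Σ X (λ x → Σ (Fin s) (λ r → w r x ≡ 1ℤ)) → Fin s
    back (_ , r , _) = r

    forth∘back : ∀ q → forth (back q) ≡ q
    forth∘back (x , r , e) with edge⇒f e
    ... | refl = ≡.cong (λ e → x , r , e) (ℤ-≡-irrelevant _ e)

module _ {s} {X : Set} {w w̃ : Fin s → X → ℤ} {f f̃ : Fin s → X}
         (edge⇒f : ∀ {r x} → w r x ≡ 1ℤ → x ≡ f r) (f-edge : ∀ r → w r (f r) ≡ 1ℤ)
         (edge⇒f̃ : ∀ {r x} → w̃ r x ≡ 1ℤ → x ≡ f̃ r) (f̃-edge : ∀ r → w̃ r (f̃ r) ≡ 1ℤ)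
         (match : ∀ x → Σ (Fin s) (λ r → w r x ≡ 1ℤ) ↔ Σ (Fin s) (λ r → w̃ r x ≡ 1ℤ)) where

  graph-permutation : Fin s ↔ Fin s
  graph-permutation =
    ↔-sym (Fin↔graph w̃ f̃ edge⇒f̃ f̃-edge) ↔-∘ (Σ-map₂-↔ match ↔-∘ Fin↔graph w f edge⇒f f-edge)

  graph-permutation-to : ∀ {r x} (e : w r x ≡ 1ℤ) →
                         to graph-permutation r ≡ proj₁ (to (match x) (r , e))
  graph-permutation-to {r} e with edge⇒f e
  ... | refl = ≡.cong (λ e → proj₁ (to (match (f r)) (r , e))) (ℤ-≡-irrelevant (f-edge r) e)

module _ {w : ℤ → ℤ → ℤ} (w01 : ∀ a b → w a b ≡ 0ℤ ⊎ w a b ≡ 1ℤ) where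

  Multi-edge : (m : Multi w) → w (s₁ m) (s₂ m) ≡ 1ℤ
  Multi-edge ((a , b , i) , 1≤i , i≤w) with w01 a b
  ... | inj₂ w≡1 = w≡1
  ... | inj₁ w≡0 with 1≤i | ≡.subst (+ i ℤ.≤_) w≡0 i≤w
  ...   | s≤s _ | +≤+ ()

  Multi-multiplicity≡1 : (m : Multi w) → proj₂ (proj₂ (proj₁ m)) ≡ 1
  Multi-multiplicity≡1 m@((_ , _ , i) , 1≤i , i≤w) =
    ℕ.≤-antisym (ℤ.drop‿+≤+ (≡.subst (+ i ℤ.≤_) (Multi-edge m) i≤w)) 1≤i

  Multi-≡ : ∀ {m n : Multi w} → s₁ m ≡ s₁ n → s₂ m ≡ s₂ n → m ≡ n
  Multi-≡ {m} {n} refl refl with ≡.trans (Multi-multiplicity≡1 m) (≡.sym (Multi-multiplicity≡1 n))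
  Multi-≡ {((a , b , i) , _)} {_} refl refl | refl =
    ≡.cong₂ (λ 1≤i i≤w → ((a , b , i) , 1≤i , i≤w)) (ℕ.≤-irrelevant _ _) (ℤ.≤-irrelevant _ _)

edge⇒Multi : ∀ {w : ℤ → ℤ → ℤ} {a b} → w a b ≡ 1ℤ → Multi w
edge⇒Multi w≡1 = (_ , _ , 1) , s≤s z≤n , ≡.subst (+ 1 ℤ.≤_) (≡.sym w≡1) ℤ.≤-refl

EdgeOwners : ∀ {s} → (Fin s → ℤ → ℤ → ℤ) → ℤ → ℤ → Set
EdgeOwners {s} W a b = Σ (Fin s) (λ r → W r a b ≡ 1ℤ)

Multi↔EdgeOwners : ∀ {s} {W : Fin s → ℤ → ℤ → ℤ} → (∀ r a b → W r a b ≡ 0ℤ ⊎ W r a b ≡ 1ℤ) →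
                   Σ (Fin s) (λ r → Multi (W r)) ↔ Σ (ℤ × ℤ) (λ (a , b) → EdgeOwners W a b)
Multi↔EdgeOwners {W = W} W01 = mk↔ₛ′ forth back forth∘back back∘forth
  where
  forth : Σ _ (λ r → Multi (W r)) → Σ (ℤ × ℤ) (λ (a , b) → EdgeOwners W a b)
  forth (r , m) = (s₁ m , s₂ m) , r , Multi-edge (W01 r) m

  back : Σ (ℤ × ℤ) (λ (a , b) → EdgeOwners W a b) → Σ _ (λ r → Multi (W r))
  back (_ , r , e) = r , edge⇒Multi e

  forth∘back : ∀ q → forth (back q) ≡ q
  forth∘back (ab , r , e) = ≡.cong (λ e → ab , r , e) (ℤ-≡-irrelevant _ e)

  back∘forth : ∀ p → back (forth p) ≡ p
  back∘forth (r , m) = ≡.cong (r ,_) (Multi-≡ (W01 r) refl refl)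

module PerfectMatching {w : ℤ → ℤ → ℤ} (pm : IsPerfectMatching w) where

  π : ℤ → ℤ
  π = proj₁ (proj₂ pm)

  π-injective : Injective _≡_ _≡_ π
  π-injective = proj₁ (proj₁ (proj₂ (proj₂ pm)))

  π⁻¹ : ℤ → ℤ
  π⁻¹ b = proj₁ (proj₂ (proj₁ (proj₂ (proj₂ pm))) b)

  π∘π⁻¹ : ∀ b → π (π⁻¹ b) ≡ b
  π∘π⁻¹ b = proj₂ (proj₂ (proj₁ (proj₂ (proj₂ pm))) b) refl

  private
    edge-spec : ∀ a b → (b ≡ π a → w a b ≡ 1ℤ) × (b ≢ π a → w a b ≡ 0ℤ)
    edge-spec = proj₂ (proj₂ (proj₂ pm))

  zero-or-one : ∀ a b → w a b ≡ 0ℤ ⊎ w a b ≡ 1ℤ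
  zero-or-one a b with b ℤ.≟ π a
  ... | yes b≡πa = inj₂ (proj₁ (edge-spec a b) b≡πa)
  ... | no b≢πa  = inj₁ (proj₂ (edge-spec a b) b≢πa)

  π-edge : ∀ a → w a (π a) ≡ 1ℤ
  π-edge a = proj₁ (edge-spec a (π a)) refl

  π⁻¹-edge : ∀ b → w (π⁻¹ b) b ≡ 1ℤ
  π⁻¹-edge b = proj₁ (edge-spec (π⁻¹ b) b) (≡.sym (π∘π⁻¹ b))

  edge⇒π : ∀ {a b} → w a b ≡ 1ℤ → b ≡ π a
  edge⇒π {a} {b} w≡1 with b ℤ.≟ π a
  ... | yes b≡πa = b≡πa
  ... | no b≢πa  = ⊥-elim (0ℤ≢1ℤ (≡.trans (≡.sym (proj₂ (edge-spec a b) b≢πa)) w≡1))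

  edge⇒π⁻¹ : ∀ {a b} → w a b ≡ 1ℤ → a ≡ π⁻¹ b
  edge⇒π⁻¹ {a} {b} w≡1 = π-injective (≡.trans (≡.sym (edge⇒π w≡1)) (≡.sym (π∘π⁻¹ b)))

  s₁-injective : Injective _≡_ _≡_ (s₁ {w})
  s₁-injective {m} {n} a≡a = Multi-≡ zero-or-one a≡a (begin
      s₂ m        ≡⟨ edge⇒π (Multi-edge zero-or-one m) ⟩
      π (s₁ m)    ≡⟨ ≡.cong π a≡a ⟩
      π (s₁ n)    ≡⟨ edge⇒π (Multi-edge zero-or-one n) ⟨
      s₂ n        ∎)
    where open ≡.≡-Reasoning

  s₂-injective : Injective _≡_ _≡_ (s₂ {w})
  s₂-injective {m} {n} b≡b = Multi-≡ zero-or-one (begin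
      s₁ m        ≡⟨ edge⇒π⁻¹ (Multi-edge zero-or-one m) ⟩
      π⁻¹ (s₂ m)  ≡⟨ ≡.cong π⁻¹ b≡b ⟩
      π⁻¹ (s₂ n)  ≡⟨ edge⇒π⁻¹ (Multi-edge zero-or-one n) ⟨
      s₁ n        ∎) b≡b
    where open ≡.≡-Reasoning

  s₁-surjective : ∀ a → ∃ λ (m : Multi w) → s₁ m ≡ a
  s₁-surjective a = edge⇒Multi (π-edge a) , refl

  s₂-surjective : ∀ b → ∃ λ (m : Multi w) → s₂ m ≡ b
  s₂-surjective b = edge⇒Multi (π⁻¹-edge b) , refl

ℤ≤-proj₁-injective : ∀ {d} → Injective _≡_ _≡_ (proj₁ {B = λ n → n ℤ.≤ d})
ℤ≤-proj₁-injective {x = a , p} {_ , q} refl = ≡.cong (a ,_) (ℤ.≤-irrelevant p q)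

ℤ≤-image? : ∀ d v → Dec (∃ λ (m : ℤ≤ d) → proj₁ m ≡ v)
ℤ≤-image? d v = Dec.map′ (λ v≤d → (v , v≤d) , refl) (λ { ((_ , v≤d) , refl) → v≤d }) (v ℤ.≤? d)

-- Direct sums of free vector spaces

module FreeSums {c ℓ : Level} (F : Field c ℓ) where

  open Over F
  open Field F
    using (0#; _*_; +-cong; *-cong; +-identityˡ; +-identityʳ; +-assoc; zeroʳ; distribˡ; setoid)
    renaming (_≈_ to _≈ₖ_; _+_ to _+ₖ_; refl to ≈-refl; sym to ≈-sym; trans to ≈-trans)
  open import Relation.Binary.Reasoning.Setoid setoid

  module _ {A : Set} (_≟_ : DecidableEquality A) where

    coeff-++ : ∀ l l′ t → coeff _≟_ (l ++ l′) t ≈ₖ (coeff _≟_ l t +ₖ coeff _≟_ l′ t)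
    coeff-++ [] l′ t = ≈-sym (+-identityˡ _)
    coeff-++ ((a , u) ∷ l) l′ t with u ≟ t
    ... | yes _ = ≈-trans (+-cong ≈-refl (coeff-++ l l′ t)) (≈-sym (+-assoc _ _ _))
    ... | no _  = coeff-++ l l′ t

    coeff-· : ∀ a l t → coeff _≟_ (_·_ (Free _≟_) a l) t ≈ₖ (a * coeff _≟_ l t)
    coeff-· a [] t = ≈-sym (zeroʳ a)
    coeff-· a ((b , u) ∷ l) t with u ≟ t
    ... | yes _ = ≈-trans (+-cong ≈-refl (coeff-· a l t)) (≈-sym (distribˡ _ _ _))
    ... | no _  = coeff-· a l t

  module _ {A B : Set} (_≟A_ : DecidableEquality A) (_≟B_ : DecidableEquality B) {h : A → B} where

    coeff-induced : Injective _≡_ _≡_ h → ∀ {u t} → h u ≡ t →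
                    ∀ l → coeff _≟B_ (induced h l) t ≈ₖ coeff _≟A_ l u
    coeff-induced h-inj hu≡t [] = ≈-refl
    coeff-induced h-inj {u} {t} hu≡t ((a , v) ∷ l) with h v ≟B t | v ≟A u
    ... | yes _   | yes _ = +-cong ≈-refl (coeff-induced h-inj hu≡t l)
    ... | yes hv≡t | no v≢u = ⊥-elim (v≢u (h-inj (≡.trans hv≡t (≡.sym hu≡t))))
    ... | no hv≢t | yes refl = ⊥-elim (hv≢t hu≡t)
    ... | no _    | no _  = coeff-induced h-inj hu≡t l

  coeff-induced-∉ : ∀ {A B : Set} (_≟_ : DecidableEquality B) {h : A → B} {t} →
                    (∀ u → h u ≢ t) → ∀ l → coeff _≟_ (induced h l) t ≈ₖ 0#
  coeff-induced-∉ _≟_ t∉h [] = ≈-refl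
  coeff-induced-∉ _≟_ {h} {t} t∉h ((a , u) ∷ l) with h u ≟ t
  ... | yes hu≡t = ⊥-elim (t∉h u hu≡t)
  ... | no _     = coeff-induced-∉ _≟_ t∉h l

  module _ {s : ℕ} {S : Fin s → Set} (d : ∀ r → DecidableEquality (S r)) where

    ⨁Free : Space
    ⨁Free = ⨁ˢ (λ r → Free (d r))

    Σ-≟ : DecidableEquality (Σ (Fin s) S)
    Σ-≟ = ≡-dec Fin._≟_ (d _)

    coeff⨁ : Carrier ⨁Free → Σ (Fin s) S → K
    coeff⨁ x p = coeff (d (proj₁ p)) (x (proj₁ p)) (proj₂ p)

    unflatten : (r : Fin s) → List (K × Σ (Fin s) S) → List (K × S r)
    unflatten r [] = []
    unflatten r ((a , (r′ , t)) ∷ y) with r′ Fin.≟ r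
    ... | yes refl = (a , t) ∷ unflatten r y
    ... | no _     = unflatten r y

    coeff-unflatten : ∀ r y t → coeff (d r) (unflatten r y) t ≈ₖ coeff Σ-≟ y (r , t)
    coeff-unflatten r [] t = ≈-refl
    coeff-unflatten r ((a , (r′ , t′)) ∷ y) t with r′ Fin.≟ r
    ... | no _ = coeff-unflatten r y t
    ... | yes refl with d r t′ t
    ...   | yes refl = +-cong ≈-refl (coeff-unflatten r y t)
    ...   | no _     = coeff-unflatten r y t

  induced⨁ : ∀ {s} {S U : Fin s → Set} → (∀ {r} → S r → U r) →
             ((r : Fin s) → List (K × S r)) → (r : Fin s) → List (K × U r)
  induced⨁ h x r = induced h (x r)

  flatten : ∀ {s} {S : Fin s → Set} → ((r : Fin s) → List (K × S r)) → List (K × Σ (Fin s) S)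
  flatten {zero}  x = []
  flatten {suc s} x =
    induced (zero ,_) (x zero) ++ induced (Prod.map suc id) (flatten (λ r → x (suc r)))

  coeff-flatten : ∀ {s} {S : Fin s → Set} (d : ∀ r → DecidableEquality (S r)) x p →
                  coeff (Σ-≟ d) (flatten x) p ≈ₖ coeff⨁ d x p
  coeff-flatten {suc s} d x (zero , t) = begin
      coeff (Σ-≟ d) (flatten x) (zero , t)
    ≈⟨ coeff-++ (Σ-≟ d) (induced (zero ,_) (x zero)) _ _ ⟩
      coeff (Σ-≟ d) (induced (zero ,_) (x zero)) (zero , t) +ₖ _
    ≈⟨ +-cong (coeff-induced (d zero) (Σ-≟ d) (λ { refl → refl }) refl (x zero))
              (coeff-induced-∉ (Σ-≟ d) (λ _ ()) (flatten (λ r → x (suc r)))) ⟩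
      coeff (d zero) (x zero) t +ₖ 0#
    ≈⟨ +-identityʳ _ ⟩
      coeff (d zero) (x zero) t
    ∎
  coeff-flatten {suc s} d x (suc r , t) = begin
      coeff (Σ-≟ d) (flatten x) (suc r , t)
    ≈⟨ coeff-++ (Σ-≟ d) (induced (zero ,_) (x zero)) _ _ ⟩
      _ +ₖ coeff (Σ-≟ d) (induced (Prod.map suc id) (flatten (λ r → x (suc r)))) (suc r , t)
    ≈⟨ +-cong (coeff-induced-∉ (Σ-≟ d) (λ _ ()) (x zero))
              (coeff-induced (Σ-≟ (λ r → d (suc r))) (Σ-≟ d) {h = Prod.map suc id}
                             (λ { refl → refl }) refl (flatten (λ r → x (suc r)))) ⟩
      0# +ₖ coeff (Σ-≟ (λ r → d (suc r))) (flatten (λ r → x (suc r))) (r , t)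
    ≈⟨ +-identityˡ _ ⟩
      coeff (Σ-≟ (λ r → d (suc r))) (flatten (λ r → x (suc r))) (r , t)
    ≈⟨ coeff-flatten (λ r → d (suc r)) (λ r → x (suc r)) (r , t) ⟩
      coeff (d (suc r)) (x (suc r)) t
    ∎

  module _ {s} {S T : Fin s → Set}
           (dS : ∀ r → DecidableEquality (S r)) (dT : ∀ r → DecidableEquality (T r)) where

    pullback-linear : (f : Carrier (⨁Free dS) → Carrier (⨁Free dT)) →
                      (ι : Σ (Fin s) T → Σ (Fin s) S) →
                      (∀ x p → coeff⨁ dT (f x) p ≈ₖ coeff⨁ dS x (ι p)) →
                      LinearMap (⨁Free dS) (⨁Free dT)
    pullback-linear f ι f-coeff = record { fun = f ; cong = f-cong ; +-hom = f-+ ; ·-hom = f-· }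
      where
      open Space using (_+_; _·_)

      f-cong : ∀ {x y} → _≈_ (⨁Free dS) x y → _≈_ (⨁Free dT) (f x) (f y)
      f-cong {x} {y} x≈y r t = begin
          coeff⨁ dT (f x) (r , t)  ≈⟨ f-coeff x (r , t) ⟩
          coeff⨁ dS x (ι (r , t))  ≈⟨ x≈y _ _ ⟩
          coeff⨁ dS y (ι (r , t))  ≈⟨ ≈-sym (f-coeff y (r , t)) ⟩
          coeff⨁ dT (f y) (r , t)  ∎

      f-+ : ∀ x y → _≈_ (⨁Free dT) (f (_+_ (⨁Free dS) x y)) (_+_ (⨁Free dT) (f x) (f y))
      f-+ x y r t = let (r₀ , t₀) = ι (r , t) in begin
          coeff⨁ dT (f (_+_ (⨁Free dS) x y)) (r , t)
        ≈⟨ f-coeff _ (r , t) ⟩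
          coeff (dS r₀) (x r₀ ++ y r₀) t₀
        ≈⟨ coeff-++ (dS r₀) (x r₀) (y r₀) t₀ ⟩
          coeff⨁ dS x (r₀ , t₀) +ₖ coeff⨁ dS y (r₀ , t₀)
        ≈⟨ +-cong (f-coeff x (r , t)) (f-coeff y (r , t)) ⟨
          coeff (dT r) (f x r) t +ₖ coeff (dT r) (f y r) t
        ≈⟨ coeff-++ (dT r) (f x r) (f y r) t ⟨
          coeff (dT r) (f x r ++ f y r) t
        ∎

      f-· : ∀ a x → _≈_ (⨁Free dT) (f (_·_ (⨁Free dS) a x)) (_·_ (⨁Free dT) a (f x))
      f-· a x r t = let (r₀ , t₀) = ι (r , t) in begin
          coeff⨁ dT (f (_·_ (⨁Free dS) a x)) (r , t)
        ≈⟨ f-coeff _ (r , t) ⟩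
          coeff (dS r₀) (_·_ (Free (dS r₀)) a (x r₀)) t₀
        ≈⟨ coeff-· (dS r₀) a (x r₀) t₀ ⟩
          a * coeff⨁ dS x (r₀ , t₀)
        ≈⟨ *-cong ≈-refl (f-coeff x (r , t)) ⟨
          a * coeff (dT r) (f x r) t
        ≈⟨ coeff-· (dT r) a (f x r) t ⟨
          coeff (dT r) (_·_ (Free (dT r)) a (f x r)) t
        ∎

  module Reindex {s} {S T : Fin s → Set}
                 (dS : ∀ r → DecidableEquality (S r)) (dT : ∀ r → DecidableEquality (T r))
                 (σ : Σ (Fin s) S ↔ Σ (Fin s) T) where

    reindex : Carrier (⨁Free dS) → Carrier (⨁Free dT)
    reindex x r = unflatten dT r (induced (to σ) (flatten x))

    coeff-reindex : ∀ x p → coeff⨁ dT (reindex x) p ≈ₖ coeff⨁ dS x (from σ p)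
    coeff-reindex x (r , t) = begin
        coeff (dT r) (reindex x r) t
      ≈⟨ coeff-unflatten dT r (induced (to σ) (flatten x)) t ⟩
        coeff (Σ-≟ dT) (induced (to σ) (flatten x)) (r , t)
      ≈⟨ coeff-induced (Σ-≟ dS) (Σ-≟ dT) (Injection.injective (↔⇒↣ σ)) (strictlyInverseˡ σ (r , t)) (flatten x) ⟩
        coeff (Σ-≟ dS) (flatten x) (from σ (r , t))
      ≈⟨ coeff-flatten dS x _ ⟩
        coeff⨁ dS x (from σ (r , t))
      ∎

    reindex-linear : LinearMap (⨁Free dS) (⨁Free dT)
    reindex-linear = pullback-linear dS dT reindex (from σ) coeff-reindex

  _≅ˡ_ : Space → Space → Set (c ⊔ ℓ)
  V ≅ˡ W = Σ (LinearMap V W) IsLinearIso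

  reindex-sym-reindex : ∀ {s} {S T : Fin s → Set}
                        (dS : ∀ r → DecidableEquality (S r)) (dT : ∀ r → DecidableEquality (T r))
                        (σ : Σ (Fin s) S ↔ Σ (Fin s) T) → ∀ x →
                        _≈_ (⨁Free dS) (Reindex.reindex dT dS (↔-sym σ) (Reindex.reindex dS dT σ x)) x
  reindex-sym-reindex dS dT σ x r t = begin
      coeff⨁ dS (Back.reindex (Forth.reindex x)) (r , t)
    ≈⟨ Back.coeff-reindex (Forth.reindex x) (r , t) ⟩
      coeff⨁ dT (Forth.reindex x) (to σ (r , t))
    ≈⟨ Forth.coeff-reindex x (to σ (r , t)) ⟩
      coeff⨁ dS x (from σ (to σ (r , t)))
    ≡⟨ ≡.cong (coeff⨁ dS x) (strictlyInverseʳ σ (r , t)) ⟩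
      coeff⨁ dS x (r , t)
    ∎
    where
    module Forth = Reindex dS dT σ
    module Back  = Reindex dT dS (↔-sym σ)

  reindex-iso : ∀ {s} {S T : Fin s → Set}
                (dS : ∀ r → DecidableEquality (S r)) (dT : ∀ r → DecidableEquality (T r)) →
                Σ (Fin s) S ↔ Σ (Fin s) T → ⨁Free dS ≅ˡ ⨁Free dT
  reindex-iso dS dT σ = Reindex.reindex-linear dS dT σ , Reindex.reindex-linear dT dS (↔-sym σ)
                      , reindex-sym-reindex dS dT σ , reindex-sym-reindex dT dS (↔-sym σ)

  module _ {s} {S T U V : Fin s → Set}
           (dS : ∀ r → DecidableEquality (S r)) (dT : ∀ r → DecidableEquality (T r))
           (dU : ∀ r → DecidableEquality (U r)) (dV : ∀ r → DecidableEquality (V r))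
           (σ : Σ (Fin s) S ↔ Σ (Fin s) T) (υ : Σ (Fin s) U ↔ Σ (Fin s) V)
           {h : ∀ {r} → S r → U r} {k : ∀ {r} → T r → V r}
           (h-injective : ∀ {r} → Injective _≡_ _≡_ (h {r}))
           (k-injective : ∀ {r} → Injective _≡_ _≡_ (k {r}))
           (k-image? : ∀ r v → Dec (∃ λ t → k {r} t ≡ v))
           (square : ∀ p → to υ (map₂ h p) ≡ map₂ k (to σ p)) where

    private
      module Rσ = Reindex dS dT σ
      module Rυ = Reindex dU dV υ

      map₂-image : ∀ {r} {v : V r} q → _≡_ {A = Σ (Fin s) V} (r , v) (map₂ k q) → ∃ λ t → k t ≡ v
      map₂-image (_ , t) refl = t , refl

    reindex-natural : ∀ x → _≈_ (⨁Free dV) (induced⨁ k (Rσ.reindex x)) (Rυ.reindex (induced⨁ h x))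
    reindex-natural x r v with k-image? r v
    ... | yes (t , refl) = begin
        coeff (dV r) (induced k (Rσ.reindex x r)) (k t)
      ≈⟨ coeff-induced (dT r) (dV r) k-injective refl (Rσ.reindex x r) ⟩
        coeff⨁ dT (Rσ.reindex x) (r , t)
      ≈⟨ Rσ.coeff-reindex x (r , t) ⟩
        coeff⨁ dS x (from σ (r , t))
      ≈⟨ coeff-induced (dS _) (dU _) h-injective refl (x _) ⟨
        coeff⨁ dU (induced⨁ h x) (map₂ h (from σ (r , t)))
      ≡⟨ ≡.cong (coeff⨁ dU (induced⨁ h x)) (square-from σ υ {map₂ h} {map₂ k} square (r , t)) ⟨
        coeff⨁ dU (induced⨁ h x) (from υ (r , k t))
      ≈⟨ Rυ.coeff-reindex (induced⨁ h x) (r , k t) ⟨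
        coeff (dV r) (Rυ.reindex (induced⨁ h x) r) (k t)
      ∎
    ... | no v∉k = begin
        coeff (dV r) (induced k (Rσ.reindex x r)) v
      ≈⟨ coeff-induced-∉ (dV r) (λ t kt≡v → v∉k (t , kt≡v)) (Rσ.reindex x r) ⟩
        0#
      ≈⟨ coeff-induced-∉ (dU _) hv∉h (x _) ⟨
        coeff⨁ dU (induced⨁ h x) (from υ (r , v))
      ≈⟨ Rυ.coeff-reindex (induced⨁ h x) (r , v) ⟨
        coeff (dV r) (Rυ.reindex (induced⨁ h x) r) v
      ∎
      where
      hv∉h : ∀ m → h m ≢ proj₂ (from υ (r , v))
      hv∉h m hm≡v = v∉k (map₂-image (to σ (_ , m))
                          (square-from⁻¹ σ υ {map₂ h} {map₂ k} square (≡.cong (_ ,_) (≡.sym hm≡v))))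

module _ {c ℓ : Level} (k : Field c ℓ) {s} {W W̃ : Fin s → ℤ → ℤ → ℤ}
         (pm : ∀ r → IsPerfectMatching (W r)) (p̃m : ∀ r → IsPerfectMatching (W̃ r))
         (match : ∀ a b → EdgeOwners W a b ↔ EdgeOwners W̃ a b) where

  open Over k
  open FreeSums k
  private
    module PM (r : Fin s) = PerfectMatching (pm r)
    module P̃M (r : Fin s) = PerfectMatching (p̃m r)

  row-permutation : ℤ → Fin s ↔ Fin s
  row-permutation a = graph-permutation (PM.edge⇒π _) (λ r → PM.π-edge r a)
                                        (P̃M.edge⇒π _) (λ r → P̃M.π-edge r a) (match a)

  column-permutation : ℤ → Fin s ↔ Fin s
  column-permutation b = graph-permutation (PM.edge⇒π⁻¹ _) (λ r → PM.π⁻¹-edge r b)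
                                           (P̃M.edge⇒π⁻¹ _) (λ r → P̃M.π⁻¹-edge r b) (λ a → match a b)

  row-permutation-to : ∀ {r a b} (e : W r a b ≡ 1ℤ) →
                       to (row-permutation a) r ≡ proj₁ (to (match a b) (r , e))
  row-permutation-to = graph-permutation-to (PM.edge⇒π _) (λ r → PM.π-edge r _)
                                            (P̃M.edge⇒π _) (λ r → P̃M.π-edge r _) (match _)

  column-permutation-to : ∀ {r a b} (e : W r a b ≡ 1ℤ) →
                          to (column-permutation b) r ≡ proj₁ (to (match a b) (r , e))
  column-permutation-to = graph-permutation-to (PM.edge⇒π⁻¹ _) (λ r → PM.π⁻¹-edge r _)
                                               (P̃M.edge⇒π⁻¹ _) (λ r → P̃M.π⁻¹-edge r _) (λ a → match a _)

  Multi-permutation : Σ (Fin s) (λ r → Multi (W r)) ↔ Σ (Fin s) (λ r → Multi (W̃ r))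
  Multi-permutation = ↔-sym (Multi↔EdgeOwners P̃M.zero-or-one)
                      ↔-∘ (Σ-map₂-↔ (λ (a , b) → match a b) ↔-∘ Multi↔EdgeOwners PM.zero-or-one)

  row-reindexing column-reindexing : ∀ {X : Set} → (X → ℤ) →
                                     Σ (Fin s) (λ _ → X) ↔ Σ (Fin s) (λ _ → X)
  row-reindexing    coordinate = fibrewise-↔ (λ x → row-permutation (coordinate x))
  column-reindexing coordinate = fibrewise-↔ (λ x → column-permutation (coordinate x))

  s₁-square : ∀ p → to (row-reindexing id) (map₂ s₁ p) ≡ map₂ s₁ (to Multi-permutation p)
  s₁-square (r , m) = ≡.cong (_, s₁ m) (row-permutation-to (Multi-edge (PM.zero-or-one r) m))

  s₂-square : ∀ p → to (column-reindexing id) (map₂ s₂ p) ≡ map₂ s₂ (to Multi-permutation p)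
  s₂-square (r , m) = ≡.cong (_, s₂ m) (column-permutation-to (Multi-edge (PM.zero-or-one r) m))

  ⨁𝓜-≅ : (d : ℤ × ℤ) → ⨁ (λ r → 𝓜 (W r) d) ≅ ⨁ (λ r → 𝓜 (W̃ r) d)
  ⨁𝓜-≅ d@(d₁ , d₂) = morphism , proj₂ isoB₁ , proj₂ isoB₂ , proj₂ isoB₃ , proj₂ isoA₁ , proj₂ isoA₂
    where
    𝓕 𝓖 : Diagram
    𝓕 = ⨁ (λ r → 𝓜 (W r) d)
    𝓖 = ⨁ (λ r → 𝓜 (W̃ r) d)

    ≟B₁ ≟B₂ : Fin s → DecidableEquality (ℤ≤ _)
    ≟B₁ _ = ℤ≤-≟ d₁
    ≟B₂ _ = ℤ≤-≟ d₂
    ≟B₃ ≟B̃₃ : ∀ r → DecidableEquality (Multi _)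
    ≟B₃ r = Multi-≟ (W r)
    ≟B̃₃ r = Multi-≟ (W̃ r)
    ≟A : Fin s → DecidableEquality ℤ
    ≟A _ = ℤ._≟_

    isoB₁ : B₁ 𝓕 ≅ˡ B₁ 𝓖
    isoB₁ = reindex-iso ≟B₁ ≟B₁ (row-reindexing proj₁)
    isoB₂ : B₂ 𝓕 ≅ˡ B₂ 𝓖
    isoB₂ = reindex-iso ≟B₂ ≟B₂ (column-reindexing proj₁)
    isoB₃ : B₃ 𝓕 ≅ˡ B₃ 𝓖
    isoB₃ = reindex-iso ≟B₃ ≟B̃₃ Multi-permutation
    isoA₁ : A₁ 𝓕 ≅ˡ A₁ 𝓖
    isoA₁ = reindex-iso ≟A ≟A (row-reindexing id)
    isoA₂ : A₂ 𝓕 ≅ˡ A₂ 𝓖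
    isoA₂ = reindex-iso ≟A ≟A (column-reindexing id)

    morphism : Morphism 𝓕 𝓖
    morphism = record
      { φB₁ = proj₁ isoB₁ ; φB₂ = proj₁ isoB₂ ; φB₃ = proj₁ isoB₃
      ; φA₁ = proj₁ isoA₁ ; φA₂ = proj₁ isoA₂
      ; comm₁₁ = reindex-natural ≟B₁ ≟B₁ ≟A ≟A (row-reindexing proj₁) (row-reindexing id)
                   ℤ≤-proj₁-injective ℤ≤-proj₁-injective (λ _ → ℤ≤-image? d₁) (λ _ → refl)
      ; comm₂₂ = reindex-natural ≟B₂ ≟B₂ ≟A ≟A (column-reindexing proj₁) (column-reindexing id)
                   ℤ≤-proj₁-injective ℤ≤-proj₁-injective (λ _ → ℤ≤-image? d₂) (λ _ → refl)
      ; comm₃₁ = reindex-natural ≟B₃ ≟B̃₃ ≟A ≟A Multi-permutation (row-reindexing id)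
                   (PM.s₁-injective _) (P̃M.s₁-injective _)
                   (λ r v → yes (P̃M.s₁-surjective r v)) s₁-square
      ; comm₃₂ = reindex-natural ≟B₃ ≟B̃₃ ≟A ≟A Multi-permutation (column-reindexing id)
                   (PM.s₂-injective _) (P̃M.s₂-injective _)
                   (λ r v → yes (P̃M.s₂-surjective r v)) s₂-square
      }

theorem6p1 : ∀ {c ℓ : Level} (k : Field c ℓ) (s : ℕ)
    (W W̃ : Fin s → ℤ → ℤ → ℤ)
    → (∀ r → IsPerfectMatching (W r))
    → (∀ r → IsPerfectMatching (W̃ r))
    → (∀ i j → ∑ (λ r → W r i j) ≡ ∑ (λ r → W̃ r i j))
    → (d : ℤ × ℤ)
    → Over._≅_ k (Over.⨁ k (λ r → Over.𝓜 k (W r) d))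
                 (Over.⨁ k (λ r → Over.𝓜 k (W̃ r) d))
theorem6p1 k s W W̃ pm p̃m ∑≡∑ = ⨁𝓜-≅ k pm p̃m match
  where
  match : ∀ a b → EdgeOwners W a b ↔ EdgeOwners W̃ a b
  match a b = equal-sums⇒supports-↔ (λ r → W r a b) (λ r → W̃ r a b)
                (λ r → PerfectMatching.zero-or-one (pm r) a b)
                (λ r → PerfectMatching.zero-or-one (p̃m r) a b)
                (∑≡∑ a b)
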